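{- Let $n\geq 2$, $s\geq 1$. Then \[ F_s(a)\geq s^{\frac{1}{n-1}}\left((n-1)!\,a_1\cdots a_n\right)^{\frac{1}{n-1}}-(a_1+\cdots+a_n), \] \[ F_s(a)\leq F_1(a)+(s-1)^{\frac{1}{n-1}}\left((n-1)!\,a_1\cdots a_n\right)^{\frac{1}{n-1}}. \]
   Context: Let $a=(a_1,\dots,a_n)\in\mathbb{Z}_{>0}^n$ with $\gcd(a)=1$. For a positive integer $s$, the $s$-Frobenius number is $F_s(a)=\max\{b\in\mathbb{Z}: \#\{z\in\mathbb{Z}_{\geq 0}^n : \langle a,z\rangle=b\}<s\}$; $F_1(a)$ is the classical Frobenius number. -}

module Defs where

open import Data.Nat as ℕ using (ℕ; zero; suc; _≟_)
open import Data.Nat.GCD using (gcd)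
open import Data.Integer as ℤ using (ℤ; +_; -[1+_])
open import Data.List using (List; []; _∷_; [_]; concatMap; map; upTo; filter; length)
open import Data.Vec as Vec using (Vec)
open import Data.Product using (_×_)

dot : ∀ {n} → Vec ℕ n → Vec ℕ n → ℕ
dot a z = Vec.sum (Vec.zipWith ℕ._*_ a z)

box : (n : ℕ) → ℕ → List (Vec ℕ n)
box zero    b = [ Vec.[] ]
box (suc n) b = concatMap (λ k → map (k Vec.∷_) (box n b)) (upTo (suc b))

-- the list of z ∈ ℤ≥0^n with ⟨a,z⟩ = b (for a with positive entries every
-- such z lies in the box {0,…,b}^n)
solutions : ∀ {n} → Vec ℕ n → ℕ → List (Vec ℕ n)
solutions {n} a b = filter (λ z → dot a z ≟ b) (box n b)

numReps : ∀ {n} → Vec ℕ n → ℤ → ℕ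
numReps a (+ b)    = length (solutions a b)
numReps a -[1+ _ ] = 0

IsFrobeniusNumber : ∀ {n} → ℕ → Vec ℕ n → ℤ → Set
IsFrobeniusNumber s a F =
  (numReps a F ℕ.< s) × (∀ (b : ℤ) → F ℤ.< b → s ℕ.≤ numReps a b)

gcdVec : ∀ {n} → Vec ℕ n → ℕ
gcdVec = Vec.foldr _ gcd 0

AllPositive : ∀ {n} → Vec ℕ n → Set
AllPositive a = ∀ i → 0 ℕ.< Vec.lookup a i

prodVec : ∀ {n} → Vec ℕ n → ℕ
prodVec = Vec.foldr _ ℕ._*_ 1

module Submission where

-- Let N(r) = #{ z ∈ ℤ≥0^n : ⟨a,z⟩ = r } and G(D) = Σ_{r<D} N(r), the number of lattice
-- points in the simplex ⟨a,z⟩ < D.  Splitting off the first coordinate gives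
--   N_{a₁,a'}(r) = N_{a'}(r) + N_{a₁,a'}(r - a₁),   G_{a₁,a'}(D) = G_{a'}(D) + G_{a₁,a'}(D - a₁),
-- and from these, by induction on the dimension m and binomial estimates, the volume
-- bounds  D^m ≤ m! Πa · G(D)  and  m! Πa · G(D+1) ≤ (D + Σa)^m.
-- Lower bound: the a₁ values F_s+1, …, F_s+a₁ each have at least s representations,
-- forcing G_{a'}(F_s + a₁) ≥ a₁ s; the volume upper bound in dimension n-1 gives
-- s (n-1)! Πa ≤ (F_s + Σa)^{n-1}.
-- Upper bound: for d = F_s - F₁ > 0 and t < d, F_s - t > F₁ is representable, and
-- adding a representable value never decreases N, so N(t) ≤ N(F_s) ≤ s - 1.  Hence
-- G_{a'}(d) ≤ a₁ (s-1), and the volume lower bound gives d^{n-1} ≤ (s-1) (n-1)! Πa.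

open import Defs
open import Data.Nat as ℕ using (ℕ; _∸_; _!)
open import Data.Integer as ℤ using (ℤ; +_)
open import Data.Vec as Vec using (Vec)
open import Data.Product using (_×_)
open import Data.Sum using (_⊎_)
open import Relation.Binary.PropositionalEquality using (_≡_)

open import Data.Nat using (zero; suc; _+_; _*_; _^_; _⊓_; _≤_; _<_; z≤n; s≤s; _≤?_; _<?_; _≟_)
open import Data.Nat.Properties
open import Data.Nat.Induction using (<-rec)
open import Data.Nat.ListAction using (sum)
open import Data.Nat.ListAction.Properties using (sum-++)
open import Data.Nat.Tactic.RingSolver using (solve-∀)
open import Data.Integer using (-[1+_])
import Data.Integer.Properties as ℤP
import Data.Integer.Tactic.RingSolver as ℤRing
open import Data.List using (List; []; _∷_; _++_; map; filter; length; concatMap; applyUpTo)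
open import Data.List.Properties using (length-++; filter-++; filter-none; filter-≐; applyUpTo-∷ʳ; map-applyUpTo)
open import Data.List.Relation.Unary.All using (universal)
open import Data.Vec using ([]; _∷_)
open import Data.Fin using () renaming (zero to fzero; suc to fsuc)
open import Data.Product using (_,_; Σ-syntax)
open import Data.Sum using (inj₁; inj₂)
open import Data.Empty using (⊥-elim)
open import Relation.Nullary using (¬_; yes; no)
open import Relation.Unary using (Pred; Decidable)
open import Relation.Binary.PropositionalEquality using (refl; sym; trans; cong; cong₂; subst; subst₂; module ≡-Reasoning)
open import Level using (0ℓ)
open import Function using (_∘_)

-- ∑< m f = f 0 + ⋯ + f (m - 1); it unfolds as ∑< (suc m) f = f 0 + ∑< m (f ∘ suc).
∑< : ℕ → (ℕ → ℕ) → ℕ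
∑< m f = sum (applyUpTo f m)

∑<-snoc : ∀ m f → ∑< (suc m) f ≡ ∑< m f + f m
∑<-snoc m f = begin
    sum (applyUpTo f (suc m))        ≡⟨ cong sum (sym (applyUpTo-∷ʳ f m)) ⟩
    sum (applyUpTo f m ++ f m ∷ [])  ≡⟨ sum-++ (applyUpTo f m) (f m ∷ []) ⟩
    ∑< m f + (f m + 0)               ≡⟨ cong (λ v → ∑< m f + v) (+-identityʳ (f m)) ⟩
    ∑< m f + f m                     ∎
  where open ≡-Reasoning

∑<-cong : ∀ m {f g : ℕ → ℕ} → (∀ k → f k ≡ g k) → ∑< m f ≡ ∑< m g
∑<-cong zero    f≡g = refl
∑<-cong (suc m) f≡g = cong₂ _+_ (f≡g 0) (∑<-cong m (λ k → f≡g (suc k)))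

∑<-truncate : ∀ {m m'} f → m ≤ m' → (∀ k → m ≤ k → f k ≡ 0) → ∑< m' f ≡ ∑< m f
∑<-truncate {m} f m≤m' vanish = subst (λ l → ∑< l f ≡ ∑< m f) (m∸n+n≡m m≤m') (extend (_ ∸ m))
  where
  extend : ∀ j → ∑< (j + m) f ≡ ∑< m f
  extend zero    = refl
  extend (suc j) = begin
      ∑< (suc (j + m)) f         ≡⟨ ∑<-snoc (j + m) f ⟩
      ∑< (j + m) f + f (j + m)   ≡⟨ cong₂ _+_ (extend j) (vanish (j + m) (m≤n+m m j)) ⟩
      ∑< m f + 0                 ≡⟨ +-identityʳ _ ⟩
      ∑< m f                     ∎
    where open ≡-Reasoning

∑<-block-≥ : ∀ g s f j → (∀ i → i < j → s ≤ g (f + i)) → ∑< f g + j * s ≤ ∑< (f + j) g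
∑<-block-≥ g s f zero    _     = ≤-reflexive (trans (+-identityʳ _) (cong (λ l → ∑< l g) (sym (+-identityʳ f))))
∑<-block-≥ g s f (suc j) large = begin
    ∑< f g + (s + j * s)          ≡⟨ reorder (∑< f g) s (j * s) ⟩
    (∑< f g + j * s) + s          ≤⟨ +-mono-≤ (∑<-block-≥ g s f j (λ i i<j → large i (m<n⇒m<1+n i<j))) (large j ≤-refl) ⟩
    ∑< (f + j) g + g (f + j)      ≡⟨ sym (∑<-snoc (f + j) g) ⟩
    ∑< (suc (f + j)) g            ≡⟨ cong (λ l → ∑< l g) (sym (+-suc f j)) ⟩
    ∑< (f + suc j) g              ∎
  where
  open ≤-Reasoning
  reorder : ∀ g s t → g + (s + t) ≡ (g + t) + s
  reorder = solve-∀

∑<-block-≤ : ∀ g K f j → (∀ i → i < j → g (f + i) ≤ K) → ∑< (f + j) g ≤ ∑< f g + j * K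
∑<-block-≤ g K f zero    _     = ≤-reflexive (trans (cong (λ l → ∑< l g) (+-identityʳ f)) (sym (+-identityʳ _)))
∑<-block-≤ g K f (suc j) small = begin
    ∑< (f + suc j) g              ≡⟨ cong (λ l → ∑< l g) (+-suc f j) ⟩
    ∑< (suc (f + j)) g            ≡⟨ ∑<-snoc (f + j) g ⟩
    ∑< (f + j) g + g (f + j)      ≤⟨ +-mono-≤ (∑<-block-≤ g K f j (λ i i<j → small i (m<n⇒m<1+n i<j))) (small j ≤-refl) ⟩
    (∑< f g + j * K) + K          ≡⟨ reorder (∑< f g) K (j * K) ⟩
    ∑< f g + (K + j * K)          ∎
  where
  open ≤-Reasoning
  reorder : ∀ g s t → (g + t) + s ≡ g + (s + t)
  reorder = solve-∀

module _ {A : Set} {P : Pred A 0ℓ} (P? : Decidable P) where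

  length-filter-concatMap : {B : Set} (h : B → List A) (ys : List B) →
    length (filter P? (concatMap h ys)) ≡ sum (map (λ y → length (filter P? (h y))) ys)
  length-filter-concatMap h []       = refl
  length-filter-concatMap h (y ∷ ys) = begin
      length (filter P? (h y ++ concatMap h ys))
        ≡⟨ cong length (filter-++ P? (h y) (concatMap h ys)) ⟩
      length (filter P? (h y) ++ filter P? (concatMap h ys))
        ≡⟨ length-++ (filter P? (h y)) ⟩
      length (filter P? (h y)) + length (filter P? (concatMap h ys))
        ≡⟨ cong (λ v → length (filter P? (h y)) + v) (length-filter-concatMap h ys) ⟩
      length (filter P? (h y)) + sum (map (λ y → length (filter P? (h y))) ys) ∎
    where open ≡-Reasoning

  length-filter-map : {B : Set} (f : B → A) (ys : List B) →
    length (filter P? (map f ys)) ≡ length (filter (λ y → P? (f y)) ys)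
  length-filter-map f []       = refl
  length-filter-map f (y ∷ ys) with P? (f y)
  ... | yes _ = cong suc (length-filter-map f ys)
  ... | no _  = length-filter-map f ys

  length-filter-none : (∀ x → ¬ P x) → ∀ xs → length (filter P? xs) ≡ 0
  length-filter-none none xs = cong length (filter-none P? (universal none xs))

head-pos : ∀ {n a} {as : Vec ℕ n} → AllPositive (a ∷ as) → 0 < a
head-pos pos = pos fzero

tail-pos : ∀ {n a} {as : Vec ℕ n} → AllPositive (a ∷ as) → AllPositive as
tail-pos pos i = pos (fsuc i)

k≤a*k : ∀ {a} k → 0 < a → k ≤ a * k
k≤a*k {a} k a>0 = subst (_≤ a * k) (*-identityˡ k) (*-monoˡ-≤ k a>0)

reps : ∀ {n} → Vec ℕ n → ℕ → ℕ
reps x r = numReps x (+ r)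

repsIn : ∀ {n} → ℕ → Vec ℕ n → ℕ → ℕ
repsIn {n} B x r = length (filter (λ z → dot x z ≟ r) (box n B))

slice : ∀ {n} → ℕ → ℕ → Vec ℕ n → ℕ → ℕ → ℕ
slice {n} B a as r k = length (filter (λ z → a * k + dot as z ≟ r) (box n B))

repsIn-first : ∀ {n} B a (as : Vec ℕ n) r → repsIn B (a ∷ as) r ≡ ∑< (suc B) (slice B a as r)
repsIn-first {n} B a as r = begin
    repsIn B (a ∷ as) r
      ≡⟨ length-filter-concatMap P? (λ k → map (k ∷_) (box n B)) (applyUpTo (λ k → k) (suc B)) ⟩
    sum (map (λ k → length (filter P? (map (k ∷_) (box n B)))) (applyUpTo (λ k → k) (suc B)))
      ≡⟨ cong sum (map-applyUpTo (λ k → k) _ (suc B)) ⟩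
    ∑< (suc B) (λ k → length (filter P? (map (k ∷_) (box n B))))
      ≡⟨ ∑<-cong (suc B) (λ k → length-filter-map P? (k ∷_) (box n B)) ⟩
    ∑< (suc B) (slice B a as r) ∎
  where
  open ≡-Reasoning
  P? = λ (z : Vec ℕ (suc n)) → dot (a ∷ as) z ≟ r

slice-fits : ∀ {n} B a (as : Vec ℕ n) r k → a * k ≤ r → slice B a as r k ≡ repsIn B as (r ∸ a * k)
slice-fits {n} B a as r k ak≤r = cong length (filter-≐ _ _ (forth , back) (box n B))
  where
  forth : ∀ {z} → a * k + dot as z ≡ r → dot as z ≡ r ∸ a * k
  forth {z} eq = trans (sym (m+n∸m≡n (a * k) (dot as z))) (cong (_∸ a * k) eq)
  back : ∀ {z} → dot as z ≡ r ∸ a * k → a * k + dot as z ≡ r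
  back eq = trans (cong (λ v → a * k + v) eq) (m+[n∸m]≡n ak≤r)

slice-empty : ∀ {n} B a (as : Vec ℕ n) r k → r < a * k → slice B a as r k ≡ 0
slice-empty {n} B a as r k r<ak = length-filter-none _
  (λ z eq → <⇒≱ r<ak (subst (a * k ≤_) eq (m≤m+n (a * k) (dot as z)))) (box n B)

repsIn-bound : ∀ {n} (x : Vec ℕ n) → AllPositive x → ∀ B r → r ≤ B → repsIn B x r ≡ reps x r
repsIn-bound []       _   B r _   = refl
repsIn-bound (a ∷ as) pos B r r≤B = begin
    repsIn B (a ∷ as) r        ≡⟨ repsIn-first B a as r ⟩
    ∑< (suc B) (slice B a as r) ≡⟨ ∑<-cong (suc B) same-slice ⟩
    ∑< (suc B) (slice r a as r) ≡⟨ ∑<-truncate _ (s≤s r≤B) beyond-r ⟩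
    ∑< (suc r) (slice r a as r) ≡⟨ sym (repsIn-first r a as r) ⟩
    reps (a ∷ as) r            ∎
  where
  open ≡-Reasoning
  a>0 = head-pos pos
  same-slice : ∀ k → slice B a as r k ≡ slice r a as r k
  same-slice k with a * k ≤? r
  ... | yes ak≤r = begin
      slice B a as r k        ≡⟨ slice-fits B a as r k ak≤r ⟩
      repsIn B as (r ∸ a * k) ≡⟨ repsIn-bound as (tail-pos pos) B _ (≤-trans (m∸n≤m r (a * k)) r≤B) ⟩
      reps as (r ∸ a * k)     ≡⟨ sym (repsIn-bound as (tail-pos pos) r _ (m∸n≤m r (a * k))) ⟩
      repsIn r as (r ∸ a * k) ≡⟨ sym (slice-fits r a as r k ak≤r) ⟩
      slice r a as r k        ∎
  ... | no ak≰r = trans (slice-empty B a as r k (≰⇒> ak≰r)) (sym (slice-empty r a as r k (≰⇒> ak≰r)))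
  beyond-r : ∀ k → suc r ≤ k → slice r a as r k ≡ 0
  beyond-r k r<k = slice-empty r a as r k (<-≤-trans r<k (k≤a*k k a>0))

slice-zero : ∀ {n} a (as : Vec ℕ n) → AllPositive as → ∀ r → slice r a as r 0 ≡ reps as r
slice-zero a as pos r = begin
    slice r a as r 0        ≡⟨ slice-fits r a as r 0 (subst (_≤ r) (sym (*-zeroʳ a)) z≤n) ⟩
    repsIn r as (r ∸ a * 0) ≡⟨ cong (λ v → repsIn r as (r ∸ v)) (*-zeroʳ a) ⟩
    reps as r               ∎
  where open ≡-Reasoning

reps-step : ∀ {n} a (as : Vec ℕ n) → AllPositive (a ∷ as) → ∀ r → a ≤ r →
  reps (a ∷ as) r ≡ reps as r + reps (a ∷ as) (r ∸ a)
reps-step a as pos r a≤r = begin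
    reps (a ∷ as) r                                            ≡⟨ repsIn-first r a as r ⟩
    slice r a as r 0 + ∑< r (λ k → slice r a as r (suc k))     ≡⟨ cong₂ _+_ (slice-zero a as (tail-pos pos) r) (∑<-cong r shift) ⟩
    reps as r + ∑< r (slice r a as (r ∸ a))                    ≡⟨ cong (λ v → reps as r + v) remainder ⟩
    reps as r + reps (a ∷ as) (r ∸ a)                          ∎
  where
  open ≡-Reasoning
  a>0 = head-pos pos
  shift : ∀ k → slice r a as r (suc k) ≡ slice r a as (r ∸ a) k
  shift k with a * k ≤? r ∸ a
  ... | yes fits = begin
      slice r a as r (suc k)        ≡⟨ slice-fits r a as r (suc k) fits′ ⟩
      repsIn r as (r ∸ a * suc k)   ≡⟨ cong (λ v → repsIn r as (r ∸ v)) (*-suc a k) ⟩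
      repsIn r as (r ∸ (a + a * k)) ≡⟨ cong (repsIn r as) (sym (∸-+-assoc r a (a * k))) ⟩
      repsIn r as (r ∸ a ∸ a * k)   ≡⟨ sym (slice-fits r a as (r ∸ a) k fits) ⟩
      slice r a as (r ∸ a) k        ∎
    where
    fits′ : a * suc k ≤ r
    fits′ = subst (_≤ r) (sym (*-suc a k)) (≤-trans (+-monoʳ-≤ a fits) (≤-reflexive (m+[n∸m]≡n a≤r)))
  ... | no too-big = trans (slice-empty r a as r (suc k) (≰⇒> (too-big ∘ shrink)))
                           (sym (slice-empty r a as (r ∸ a) k (≰⇒> too-big)))
    where
    shrink : a * suc k ≤ r → a * k ≤ r ∸ a
    shrink q = subst (_≤ r ∸ a) (m+n∸m≡n a (a * k)) (∸-monoˡ-≤ a (subst (_≤ r) (*-suc a k) q))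
  remainder : ∑< r (slice r a as (r ∸ a)) ≡ reps (a ∷ as) (r ∸ a)
  remainder = begin
      ∑< r (slice r a as (r ∸ a))         ≡⟨ sym (∑<-truncate _ (n≤1+n r) last-empty) ⟩
      ∑< (suc r) (slice r a as (r ∸ a))   ≡⟨ sym (repsIn-first r a as (r ∸ a)) ⟩
      repsIn r (a ∷ as) (r ∸ a)           ≡⟨ repsIn-bound (a ∷ as) pos r (r ∸ a) (m∸n≤m r a) ⟩
      reps (a ∷ as) (r ∸ a)               ∎
    where
    last-empty : ∀ k → r ≤ k → slice r a as (r ∸ a) k ≡ 0
    last-empty k r≤k = slice-empty r a as (r ∸ a) k (<-≤-trans (∸-monoʳ-< a>0 a≤r) (≤-trans r≤k (k≤a*k k a>0)))

reps-small : ∀ {n} a (as : Vec ℕ n) → AllPositive (a ∷ as) → ∀ r → r < a → reps (a ∷ as) r ≡ reps as r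
reps-small a as pos r r<a = begin
    reps (a ∷ as) r              ≡⟨ repsIn-first r a as r ⟩
    ∑< (suc r) (slice r a as r)  ≡⟨ ∑<-truncate {1} {suc r} _ (s≤s z≤n) positive-first ⟩
    slice r a as r 0 + 0         ≡⟨ +-identityʳ _ ⟩
    slice r a as r 0             ≡⟨ slice-zero a as (tail-pos pos) r ⟩
    reps as r                    ∎
  where
  open ≡-Reasoning
  positive-first : ∀ k → 1 ≤ k → slice r a as r k ≡ 0
  positive-first (suc k) _ = slice-empty r a as r (suc k) (<-≤-trans r<a (subst (a ≤_) (sym (*-suc a k)) (m≤m+n a (a * k))))

-- Representations by the tail are those with first coordinate 0, so N_{as} ≤ N_{a,as}.
reps-tail-≤ : ∀ {n} a (as : Vec ℕ n) → AllPositive (a ∷ as) → ∀ r → reps as r ≤ reps (a ∷ as) r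
reps-tail-≤ a as pos r with a ≤? r
... | yes a≤r = subst (reps as r ≤_) (sym (reps-step a as pos r a≤r)) (m≤m+n _ _)
... | no a≰r  = ≤-reflexive (sym (reps-small a as pos r (≰⇒> a≰r)))

reps-witness : ∀ {n} (x : Vec ℕ n) → AllPositive x → ∀ u → 1 ≤ reps x u → Σ[ w ∈ Vec ℕ n ] dot x w ≡ u
reps-witness []       _   zero    _ = [] , refl
reps-witness []       _   (suc u) ()
reps-witness {suc n} (a ∷ as) pos = <-rec Witnessed step
  where
  Witnessed : ℕ → Set
  Witnessed u = 1 ≤ reps (a ∷ as) u → Σ[ w ∈ Vec ℕ (suc n) ] dot (a ∷ as) w ≡ u
  step : ∀ u → (∀ {v} → v < u → Witnessed v) → Witnessed u
  step u ih u-rep with 1 ≤? reps as u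
  ... | yes tail-rep = let (w , dot≡u) = reps-witness as (tail-pos pos) u tail-rep
                       in (0 ∷ w) , trans (cong (_+ dot as w) (*-zeroʳ a)) dot≡u
  ... | no no-tail-rep with a ≤? u
  ...   | no a≰u = ⊥-elim (no-tail-rep (subst (1 ≤_) (reps-small a as pos u (≰⇒> a≰u)) u-rep))
  ...   | yes a≤u with ih (∸-monoʳ-< (head-pos pos) a≤u) rest-rep
    where
    -- all representations of u use a, so u - a is representable
    rest-rep : 1 ≤ reps (a ∷ as) (u ∸ a)
    rest-rep = subst (1 ≤_) (trans (reps-step a as pos u a≤u)
                 (cong (_+ reps (a ∷ as) (u ∸ a)) (n<1⇒n≡0 (≰⇒> no-tail-rep)))) u-rep
  ...     | (w₀ ∷ w) , dot≡u-a = (suc w₀ ∷ w) , (begin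
      a * suc w₀ + dot as w    ≡⟨ cong (_+ dot as w) (*-suc a w₀) ⟩
      a + a * w₀ + dot as w    ≡⟨ +-assoc a _ _ ⟩
      a + (a * w₀ + dot as w)  ≡⟨ cong (λ v → a + v) dot≡u-a ⟩
      a + (u ∸ a)              ≡⟨ m+[n∸m]≡n a≤u ⟩
      u                        ∎)
    where open ≡-Reasoning

reps-mono-first : ∀ {n} a (as : Vec ℕ n) → AllPositive (a ∷ as) → ∀ k y →
  reps (a ∷ as) y ≤ reps (a ∷ as) (y + a * k)
reps-mono-first a as pos zero    y = ≤-reflexive (cong (reps (a ∷ as)) (sym (trans (cong (λ v → y + v) (*-zeroʳ a)) (+-identityʳ y))))
reps-mono-first a as pos (suc k) y = begin
    reps x y                      ≤⟨ reps-mono-first a as pos k y ⟩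
    reps x z                      ≡⟨ cong (reps x) (sym (m+n∸n≡m z a)) ⟩
    reps x (z + a ∸ a)            ≤⟨ m≤n+m _ _ ⟩
    reps as (z + a) + reps x (z + a ∸ a) ≡⟨ sym (reps-step a as pos (z + a) (m≤n+m a z)) ⟩
    reps x (z + a)                ≡⟨ cong (reps x) (reassoc y a k) ⟩
    reps x (y + a * suc k)        ∎
  where
  open ≤-Reasoning
  x = a ∷ as
  z = y + a * k
  reassoc : ∀ y a k → y + a * k + a ≡ y + a * suc k
  reassoc = solve-∀

reps-mono-lift : ∀ {n} a (as : Vec ℕ n) → AllPositive (a ∷ as) → ∀ t →
  (∀ y → reps as y ≤ reps as (y + t)) → ∀ y → reps (a ∷ as) y ≤ reps (a ∷ as) (y + t)
reps-mono-lift a as pos t tail-mono = <-rec Mono step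
  where
  x = a ∷ as
  Mono : ℕ → Set
  Mono y = reps x y ≤ reps x (y + t)
  step : ∀ y → (∀ {v} → v < y → Mono v) → Mono y
  step y ih with a ≤? y
  ... | no a≰y = begin
      reps x y          ≡⟨ reps-small a as pos y (≰⇒> a≰y) ⟩
      reps as y         ≤⟨ tail-mono y ⟩
      reps as (y + t)   ≤⟨ reps-tail-≤ a as pos (y + t) ⟩
      reps x (y + t)    ∎
    where open ≤-Reasoning
  ... | yes a≤y = begin
      reps x y                                ≡⟨ reps-step a as pos y a≤y ⟩
      reps as y + reps x (y ∸ a)              ≤⟨ +-mono-≤ (tail-mono y) (ih (∸-monoʳ-< (head-pos pos) a≤y)) ⟩
      reps as (y + t) + reps x (y ∸ a + t)    ≡⟨ cong (λ v → reps as (y + t) + reps x v) (sym (+-∸-comm t a≤y)) ⟩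
      reps as (y + t) + reps x (y + t ∸ a)    ≡⟨ sym (reps-step a as pos (y + t) (≤-trans a≤y (m≤m+n y t))) ⟩
      reps x (y + t)                          ∎
    where open ≤-Reasoning

reps-mono : ∀ {n} (x : Vec ℕ n) → AllPositive x → ∀ w y → reps x y ≤ reps x (y + dot x w)
reps-mono []       _   []       y = ≤-reflexive (cong (reps []) (sym (+-identityʳ y)))
reps-mono (a ∷ as) pos (k ∷ w) y = begin
    reps x y                          ≤⟨ reps-mono-lift a as pos (dot as w) (reps-mono as (tail-pos pos) w) y ⟩
    reps x (y + dot as w)             ≤⟨ reps-mono-first a as pos k (y + dot as w) ⟩
    reps x (y + dot as w + a * k)     ≡⟨ cong (reps x) (reorder y (dot as w) (a * k)) ⟩
    reps x (y + (a * k + dot as w))   ∎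
  where
  open ≤-Reasoning
  x = a ∷ as
  reorder : ∀ y d c → y + d + c ≡ y + (c + d)
  reorder = solve-∀

reps-shift : ∀ {n} (x : Vec ℕ n) → AllPositive x → ∀ u → 1 ≤ reps x u → ∀ t → reps x t ≤ reps x (t + u)
reps-shift x pos u u-rep t with reps-witness x pos u u-rep
... | w , dot≡u = subst (λ v → reps x t ≤ reps x (t + v)) dot≡u (reps-mono x pos w t)

binomial-≥ : ∀ m y d → y ^ suc m + suc m * d * y ^ m ≤ (y + d) ^ suc m
binomial-≥ zero    y d = ≤-reflexive (expand y d)
  where
  expand : ∀ y d → y * 1 + 1 * d * 1 ≡ (y + d) * 1
  expand = solve-∀
binomial-≥ (suc m) y d = begin
    y * (y * Y) + suc (suc m) * d * (y * Y)        ≡⟨ regroup y d m Y ⟩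
    (y + d) * (y * Y) + suc m * d * (y * Y)        ≤⟨ +-monoʳ-≤ ((y + d) * (y * Y)) (*-monoʳ-≤ (suc m * d) (*-monoˡ-≤ Y (m≤m+n y d))) ⟩
    (y + d) * (y * Y) + suc m * d * ((y + d) * Y)  ≡⟨ factor y d m Y ⟩
    (y + d) * (y * Y + suc m * d * Y)              ≤⟨ *-monoʳ-≤ (y + d) (binomial-≥ m y d) ⟩
    (y + d) * (y + d) ^ suc m                      ∎
  where
  open ≤-Reasoning
  Y = y ^ m
  regroup : ∀ y d m Y → y * (y * Y) + suc (suc m) * d * (y * Y) ≡ (y + d) * (y * Y) + suc m * d * (y * Y)
  regroup = solve-∀
  factor : ∀ y d m Y → (y + d) * (y * Y) + suc m * d * ((y + d) * Y) ≡ (y + d) * (y * Y + suc m * d * Y)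
  factor = solve-∀

binomial-≤ : ∀ m y d → (y + d) ^ suc m ≤ y ^ suc m + suc m * d * (y + d) ^ m
binomial-≤ zero    y d = ≤-reflexive (sym (expand y d))
  where
  expand : ∀ y d → y * 1 + 1 * d * 1 ≡ (y + d) * 1
  expand = solve-∀
binomial-≤ (suc m) y d = begin
    (y + d) * (y + d) ^ suc m                                  ≤⟨ *-monoʳ-≤ (y + d) (binomial-≤ m y d) ⟩
    (y + d) * (W + suc m * d * Z)                              ≡⟨ expand y d m W Z ⟩
    y * W + (d * W + suc m * d * ((y + d) * Z))                ≤⟨ +-monoʳ-≤ (y * W) (+-monoˡ-≤ _ (*-monoʳ-≤ d (^-monoˡ-≤ (suc m) (m≤m+n y d)))) ⟩
    y * W + (d * ((y + d) * Z) + suc m * d * ((y + d) * Z))    ≡⟨ collect y d m W Z ⟩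
    y * W + suc (suc m) * d * ((y + d) * Z)                    ∎
  where
  open ≤-Reasoning
  W = y ^ suc m
  Z = (y + d) ^ m
  expand : ∀ y d m W Z → (y + d) * (W + suc m * d * Z) ≡ y * W + (d * W + suc m * d * ((y + d) * Z))
  expand = solve-∀
  collect : ∀ y d m W Z → y * W + (d * ((y + d) * Z) + suc m * d * ((y + d) * Z)) ≡ y * W + suc (suc m) * d * ((y + d) * Z)
  collect = solve-∀

repsBelow : ∀ {n} → Vec ℕ n → ℕ → ℕ
repsBelow x D = ∑< D (reps x)

repsBelow-[] : ∀ D → repsBelow [] (suc D) ≡ 1
repsBelow-[] D = cong suc (∑<-truncate {0} {D} (λ _ → 0) z≤n (λ _ _ → refl))

repsBelow-step : ∀ {n} a (as : Vec ℕ n) → AllPositive (a ∷ as) → ∀ D →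
  repsBelow (a ∷ as) D ≡ repsBelow as D + repsBelow (a ∷ as) (D ∸ a)
repsBelow-step a as pos zero    = cong (repsBelow (a ∷ as)) (sym (0∸n≡0 a))
repsBelow-step a as pos (suc D) with a ≤? D
... | yes a≤D = begin
    G x (suc D)                                  ≡⟨ ∑<-snoc D (reps x) ⟩
    G x D + reps x D                             ≡⟨ cong₂ _+_ (repsBelow-step a as pos D) (reps-step a as pos D a≤D) ⟩
    (G as D + G x (D ∸ a)) + (reps as D + reps x (D ∸ a))
      ≡⟨ interchange (G as D) (G x (D ∸ a)) (reps as D) (reps x (D ∸ a)) ⟩
    (G as D + reps as D) + (G x (D ∸ a) + reps x (D ∸ a))
      ≡⟨ sym (cong₂ _+_ (∑<-snoc D (reps as)) (∑<-snoc (D ∸ a) (reps x))) ⟩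
    G as (suc D) + G x (suc (D ∸ a))             ≡⟨ cong (λ v → G as (suc D) + G x v) (sym (+-∸-assoc 1 a≤D)) ⟩
    G as (suc D) + G x (suc D ∸ a)               ∎
  where
  open ≡-Reasoning
  G = repsBelow
  x = a ∷ as
  interchange : ∀ g₁ g₂ n₁ n₂ → (g₁ + g₂) + (n₁ + n₂) ≡ (g₁ + n₁) + (g₂ + n₂)
  interchange = solve-∀
... | no a≰D = begin
    G x (suc D)                   ≡⟨ ∑<-snoc D (reps x) ⟩
    G x D + reps x D              ≡⟨ cong₂ _+_ (repsBelow-step a as pos D) (reps-small a as pos D D<a) ⟩
    (G as D + G x (D ∸ a)) + reps as D
      ≡⟨ cong (λ v → (G as D + G x v) + reps as D) (m≤n⇒m∸n≡0 (<⇒≤ D<a)) ⟩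
    (G as D + 0) + reps as D      ≡⟨ cong (_+ reps as D) (+-identityʳ (G as D)) ⟩
    G as D + reps as D            ≡⟨ sym (∑<-snoc D (reps as)) ⟩
    G as (suc D)                  ≡⟨ sym (+-identityʳ _) ⟩
    G as (suc D) + 0              ≡⟨ cong (λ v → G as (suc D) + G x v) (sym (m≤n⇒m∸n≡0 D<a)) ⟩
    G as (suc D) + G x (suc D ∸ a) ∎
  where
  open ≡-Reasoning
  G = repsBelow
  x = a ∷ as
  D<a = ≰⇒> a≰D

repsBelow-≤ : ∀ {m} (x : Vec ℕ m) → AllPositive x → ∀ D →
  m ! * prodVec x * repsBelow x (suc D) ≤ (D + Vec.sum x) ^ m
repsBelow-≤ []                 _   D = ≤-reflexive (cong (λ v → 1 * 1 * v) (repsBelow-[] D))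
repsBelow-≤ {suc m} (a ∷ as) pos = <-rec Bound step
  where
  x = a ∷ as
  F = m !
  P = prodVec as
  S = Vec.sum as
  Bound : ℕ → Set
  Bound D = suc m * F * (a * P) * repsBelow x (suc D) ≤ (D + (a + S)) ^ suc m
  distribute : ∀ m F a P g₁ g₂ → (suc m * F) * (a * P) * (g₁ + g₂) ≡ suc m * a * (F * P * g₁) + (suc m * F) * (a * P) * g₂
  distribute = solve-∀
  step : ∀ D → (∀ {D'} → D' < D → Bound D') → Bound D
  step D ih = begin
      c * repsBelow x (suc D)                                   ≡⟨ cong (c *_) (repsBelow-step a as pos (suc D)) ⟩
      c * (repsBelow as (suc D) + repsBelow x (suc D ∸ a))      ≡⟨ distribute m F a P _ _ ⟩
      suc m * a * (F * P * repsBelow as (suc D)) + c * repsBelow x (suc D ∸ a)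
        ≤⟨ +-mono-≤ (*-monoʳ-≤ (suc m * a) (repsBelow-≤ as (tail-pos pos) D)) rest ⟩
      suc m * a * X ^ m + X ^ suc m                             ≡⟨ +-comm (suc m * a * X ^ m) (X ^ suc m) ⟩
      X ^ suc m + suc m * a * X ^ m                             ≤⟨ binomial-≥ m X a ⟩
      (X + a) ^ suc m                                           ≡⟨ cong (_^ suc m) (reorder D S a) ⟩
      (D + (a + S)) ^ suc m                                     ∎
    where
    open ≤-Reasoning
    c = suc m * F * (a * P)
    X = D + S
    reorder : ∀ D S a → D + S + a ≡ D + (a + S)
    reorder = solve-∀
    -- the points using the first entry at least once form a translate of a
    -- smaller simplex
    rest : c * repsBelow x (suc D ∸ a) ≤ X ^ suc m
    rest with a ≤? D
    ... | yes a≤D = begin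
        c * repsBelow x (suc D ∸ a)     ≡⟨ cong (λ v → c * repsBelow x v) (+-∸-assoc 1 a≤D) ⟩
        c * repsBelow x (suc (D ∸ a))   ≤⟨ ih (∸-monoʳ-< (head-pos pos) a≤D) ⟩
        (D ∸ a + (a + S)) ^ suc m       ≡⟨ cong (_^ suc m) (trans (sym (+-assoc (D ∸ a) a S)) (cong (_+ S) (m∸n+n≡m a≤D))) ⟩
        X ^ suc m                       ∎
    ... | no a≰D = begin
        c * repsBelow x (suc D ∸ a)     ≡⟨ cong (λ v → c * repsBelow x v) (m≤n⇒m∸n≡0 (≰⇒> a≰D)) ⟩
        c * 0                           ≡⟨ *-zeroʳ c ⟩
        0                               ≤⟨ z≤n ⟩
        X ^ suc m                       ∎

repsBelow-≥ : ∀ {m} (x : Vec ℕ m) → AllPositive x → ∀ D → 1 ≤ D →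
  D ^ m ≤ m ! * prodVec x * repsBelow x D
repsBelow-≥ []                 _   (suc D) _ = ≤-reflexive (sym (cong (λ v → 1 * 1 * v) (repsBelow-[] D)))
repsBelow-≥ {suc m} (a ∷ as) pos = <-rec Bound step
  where
  x = a ∷ as
  F = m !
  P = prodVec as
  Bound : ℕ → Set
  Bound D = 1 ≤ D → D ^ suc m ≤ suc m * F * (a * P) * repsBelow x D
  distribute : ∀ m F a P g₁ g₂ → (suc m * F) * (a * P) * (g₁ + g₂) ≡ suc m * a * (F * P * g₁) + (suc m * F) * (a * P) * g₂
  distribute = solve-∀
  step : ∀ D → (∀ {D'} → D' < D → Bound D') → Bound D
  step D ih D≥1 = begin
      D ^ suc m                                                  ≤⟨ split ⟩
      suc m * a * D ^ m + c * repsBelow x (D ∸ a)                ≤⟨ +-monoˡ-≤ _ (*-monoʳ-≤ (suc m * a) (repsBelow-≥ as (tail-pos pos) D D≥1)) ⟩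
      suc m * a * (F * P * repsBelow as D) + c * repsBelow x (D ∸ a) ≡⟨ sym (distribute m F a P _ _) ⟩
      c * (repsBelow as D + repsBelow x (D ∸ a))                 ≡⟨ cong (c *_) (sym (repsBelow-step a as pos D)) ⟩
      c * repsBelow x D                                          ∎
    where
    open ≤-Reasoning
    c = suc m * F * (a * P)
    split : D ^ suc m ≤ suc m * a * D ^ m + c * repsBelow x (D ∸ a)
    split with a <? D
    ... | yes a<D = begin
        D ^ suc m                                        ≡⟨ cong (_^ suc m) (sym (m∸n+n≡m (<⇒≤ a<D))) ⟩
        (D ∸ a + a) ^ suc m                              ≤⟨ binomial-≤ m (D ∸ a) a ⟩
        (D ∸ a) ^ suc m + suc m * a * (D ∸ a + a) ^ m    ≡⟨ cong (λ v → (D ∸ a) ^ suc m + suc m * a * v ^ m) (m∸n+n≡m (<⇒≤ a<D)) ⟩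
        (D ∸ a) ^ suc m + suc m * a * D ^ m              ≤⟨ +-monoˡ-≤ _ (ih (∸-monoʳ-< (head-pos pos) (<⇒≤ a<D)) (m<n⇒0<n∸m a<D)) ⟩
        c * repsBelow x (D ∸ a) + suc m * a * D ^ m      ≡⟨ +-comm (c * repsBelow x (D ∸ a)) (suc m * a * D ^ m) ⟩
        suc m * a * D ^ m + c * repsBelow x (D ∸ a)      ∎
    ... | no a≮D = begin
        D * D ^ m                                        ≤⟨ *-monoˡ-≤ (D ^ m) (≮⇒≥ a≮D) ⟩
        a * D ^ m                                        ≤⟨ m≤m+n (a * D ^ m) (m * (a * D ^ m)) ⟩
        suc m * (a * D ^ m)                              ≡⟨ sym (*-assoc (suc m) a (D ^ m)) ⟩
        suc m * a * D ^ m                                ≤⟨ m≤m+n _ _ ⟩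
        suc m * a * D ^ m + c * repsBelow x (D ∸ a)      ∎

many-reps-bound : ∀ {m} a' (as : Vec ℕ (suc m)) → AllPositive (suc a' ∷ as) → ∀ s f →
  (∀ i → i < suc a' → s ≤ reps (suc a' ∷ as) (f + i)) →
  s * suc m ! * prodVec (suc a' ∷ as) ≤ (f + a' + Vec.sum as) ^ suc m
many-reps-bound {m} a' as pos s f many = begin
    s * M ! * (a * P)                      ≡⟨ reorder s (M !) a P ⟩
    M ! * P * (a * s)                      ≤⟨ *-monoʳ-≤ (M ! * P) tail-count ⟩
    M ! * P * repsBelow as (suc (f + a'))  ≤⟨ repsBelow-≤ as (tail-pos pos) (f + a') ⟩
    (f + a' + Vec.sum as) ^ M              ∎
  where
  open ≤-Reasoning
  a = suc a'
  M = suc m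
  P = prodVec as
  x = a ∷ as
  reorder : ∀ s F a P → s * F * (a * P) ≡ F * P * (a * s)
  reorder = solve-∀
  tail-count : a * s ≤ repsBelow as (suc (f + a'))
  tail-count = +-cancelˡ-≤ (repsBelow x f) _ _ (begin
      repsBelow x f + a * s                            ≤⟨ ∑<-block-≥ (reps x) s f a many ⟩
      repsBelow x (f + a)                              ≡⟨ repsBelow-step a as pos (f + a) ⟩
      repsBelow as (f + a) + repsBelow x (f + a ∸ a)   ≡⟨ cong₂ (λ u v → repsBelow as u + repsBelow x v) (+-suc f a') (m+n∸n≡m f a) ⟩
      repsBelow as (suc (f + a')) + repsBelow x f      ≡⟨ +-comm _ (repsBelow x f) ⟩
      repsBelow x f + repsBelow as (suc (f + a'))      ∎)

few-reps-bound : ∀ {m} a (as : Vec ℕ (suc m)) → AllPositive (a ∷ as) → ∀ K d →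
  (∀ t → t < d → reps (a ∷ as) t ≤ K) → d ^ suc m ≤ K * suc m ! * prodVec (a ∷ as)
few-reps-bound {m} a as pos K zero    _   = z≤n
few-reps-bound {m} a as pos K (suc d) few = begin
    D ^ M                         ≤⟨ repsBelow-≥ as (tail-pos pos) D (s≤s z≤n) ⟩
    M ! * P * repsBelow as D      ≤⟨ *-monoʳ-≤ (M ! * P) tail-count ⟩
    M ! * P * (j * K)             ≤⟨ *-monoʳ-≤ (M ! * P) (*-monoˡ-≤ K (m⊓n≤m a D)) ⟩
    M ! * P * (a * K)             ≡⟨ reorder (M !) P a K ⟩
    K * M ! * (a * P)             ∎
  where
  open ≤-Reasoning
  D = suc d
  M = suc m
  P = prodVec as
  x = a ∷ as
  -- the last j = min(a, D) values below D, starting at f = D - a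
  f = D ∸ a
  j = a ⊓ D
  f+j≡D : f + j ≡ D
  f+j≡D = trans (+-comm f j) (m⊓n+n∸m≡n a D)
  reorder : ∀ F P a K → F * P * (a * K) ≡ K * F * (a * P)
  reorder = solve-∀
  tail-count : repsBelow as D ≤ j * K
  tail-count = +-cancelˡ-≤ (repsBelow x f) _ _ (begin
      repsBelow x f + repsBelow as D  ≡⟨ +-comm (repsBelow x f) _ ⟩
      repsBelow as D + repsBelow x f  ≡⟨ sym (repsBelow-step a as pos D) ⟩
      repsBelow x D                   ≡⟨ cong (repsBelow x) (sym f+j≡D) ⟩
      repsBelow x (f + j)             ≤⟨ ∑<-block-≤ (reps x) K f j (λ i i<j → few (f + i) (subst (f + i <_) f+j≡D (+-monoʳ-< f i<j))) ⟩
      repsBelow x f + j * K           ∎)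

pos-^ : ∀ b e → (+ b) ℤ.^ e ≡ + (b ^ e)
pos-^ b zero    = refl
pos-^ b (suc e) = trans (cong (+ b ℤ.*_) (pos-^ b e)) (sym (ℤP.pos-* b (b ^ e)))

representable-above : ∀ {n} (x : Vec ℕ n) {F₁} → IsFrobeniusNumber 1 x F₁ →
  ∀ b → F₁ ℤ.< b → Σ[ u ∈ ℕ ] (b ≡ + u) × (1 ≤ reps x u)
representable-above x (_ , above) (+ u)    F₁<b = u , refl , above (+ u) F₁<b
representable-above x (_ , above) -[1+ k ] F₁<b with above -[1+ k ] F₁<b
... | ()

beyond-F₁ : ∀ F₁ Fₛ d t → Fₛ ℤ.- F₁ ≡ + d → t < d → F₁ ℤ.< Fₛ ℤ.- + t
beyond-F₁ F₁ Fₛ d t gap t<d =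
  subst₂ ℤ._<_ (ℤP.+-identityʳ F₁) (sym split) (ℤP.+-monoʳ-< F₁ (ℤ.+<+ (m<n⇒0<n∸m t<d)))
  where
  open ≡-Reasoning
  regroup : ∀ A B T → A ℤ.- T ≡ B ℤ.+ ((A ℤ.- B) ℤ.- T)
  regroup = ℤRing.solve-∀
  split : Fₛ ℤ.- + t ≡ F₁ ℤ.+ + (d ∸ t)
  split = begin
    Fₛ ℤ.- + t                    ≡⟨ regroup Fₛ F₁ (+ t) ⟩
    F₁ ℤ.+ ((Fₛ ℤ.- F₁) ℤ.- + t)  ≡⟨ cong (λ v → F₁ ℤ.+ (v ℤ.- + t)) gap ⟩
    F₁ ℤ.+ (+ d ℤ.- + t)          ≡⟨ cong (λ v → F₁ ℤ.+ v) (trans (ℤP.m-n≡m⊖n d t) (ℤP.⊖-≥ (<⇒≤ t<d))) ⟩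
    F₁ ℤ.+ + (d ∸ t)              ∎

-- Below the gap d = F_s - F₁ every value has at most s - 1 representations:
-- F_s - t is representable, so N(t) ≤ N(t + (F_s - t)) = N(F_s) < s.
few-reps-below-gap : ∀ {n} (x : Vec ℕ n) → AllPositive x → ∀ s F₁ Fₛ →
  IsFrobeniusNumber 1 x F₁ → IsFrobeniusNumber s x Fₛ →
  ∀ d → Fₛ ℤ.- F₁ ≡ + d → ∀ t → t < d → reps x t ≤ s ∸ 1
few-reps-below-gap x pos s F₁ Fₛ fr₁ (Fₛ-few , _) d gap t t<d
  with representable-above x fr₁ (Fₛ ℤ.- + t) (beyond-F₁ F₁ Fₛ d t gap t<d)
... | u , Fₛ-t≡u , u-rep = begin
    reps x t           ≤⟨ reps-shift x pos u u-rep t ⟩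
    reps x (t + u)     ≡⟨ cong (numReps x) (sym Fₛ≡t+u) ⟩
    numReps x Fₛ       ≤⟨ ∸-monoˡ-≤ 1 Fₛ-few ⟩
    s ∸ 1              ∎
  where
  open ≤-Reasoning
  restore : ∀ A T → A ≡ (A ℤ.- T) ℤ.+ T
  restore = ℤRing.solve-∀
  Fₛ≡t+u : Fₛ ≡ + (t + u)
  Fₛ≡t+u = trans (restore Fₛ (+ t)) (trans (cong (ℤ._+ + t) Fₛ-t≡u) (cong +_ (+-comm u t)))

sum-pos : ∀ {n} (x : Vec ℕ (suc n)) → AllPositive x → 1 ≤ Vec.sum x
sum-pos (b ∷ bs) pos = ≤-trans (head-pos pos) (m≤m+n b _)

-- The lower bound, given f = F_s + 1 ≥ 0: the values f, f + 1, … all have at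
-- least s representations, and F_s + Σx = f + a' + Σas.
lower-from-start : ∀ {m} a' (as : Vec ℕ (suc m)) → AllPositive (suc a' ∷ as) → ∀ s Fₛ →
  IsFrobeniusNumber s (suc a' ∷ as) Fₛ → ∀ f → (∀ i → Fₛ ℤ.< + (f + i)) →
  Fₛ ℤ.+ + Vec.sum (suc a' ∷ as) ≡ + (f + a' + Vec.sum as) → 0 < f + a' + Vec.sum as →
  (ℤ.0ℤ ℤ.< Fₛ ℤ.+ + Vec.sum (suc a' ∷ as))
    × (+ (s ℕ.* (suc m !) ℕ.* prodVec (suc a' ∷ as)) ℤ.≤ (Fₛ ℤ.+ + Vec.sum (suc a' ∷ as)) ℤ.^ suc m)
lower-from-start {m} a' as pos s Fₛ (_ , above) f beyond total positive rewrite total =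
  ℤ.+<+ positive ,
  subst (+ (s * suc m ! * prodVec (suc a' ∷ as)) ℤ.≤_) (sym (pos-^ _ (suc m)))
    (ℤ.+≤+ (many-reps-bound a' as pos s f (λ i _ → above (+ (f + i)) (beyond i))))

-- The lower bound of the theorem: F_s ≥ -1 since -1 has no representation, and
-- both F_s = -1 and F_s ≥ 0 reduce to lower-from-start.
frobenius-lower : ∀ {m} a' (as : Vec ℕ (suc m)) → AllPositive (suc a' ∷ as) → ∀ s → 1 ≤ s → ∀ Fₛ →
  IsFrobeniusNumber s (suc a' ∷ as) Fₛ →
  (ℤ.0ℤ ℤ.< Fₛ ℤ.+ + Vec.sum (suc a' ∷ as))
    × (+ (s ℕ.* (suc m !) ℕ.* prodVec (suc a' ∷ as)) ℤ.≤ (Fₛ ℤ.+ + Vec.sum (suc a' ∷ as)) ℤ.^ suc m)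
frobenius-lower a' as pos s _ (+ k) frₛ =
  lower-from-start a' as pos s (+ k) frₛ (suc k) (λ i → ℤ.+<+ (s≤s (m≤m+n k i)))
    (cong +_ (reassoc k a' (Vec.sum as))) (s≤s z≤n)
  where
  reassoc : ∀ k a S → k + (suc a + S) ≡ suc k + a + S
  reassoc = solve-∀
frobenius-lower a' as pos s _ -[1+ zero ] frₛ =
  lower-from-start a' as pos s -[1+ zero ] frₛ 0 (λ i → ℤ.-<+) refl
    (≤-trans (sum-pos as (tail-pos pos)) (m≤n+m _ a'))
frobenius-lower a' as pos s s≥1 -[1+ suc j ] (_ , above) =
  ⊥-elim (<⇒≱ s≥1 (above -[1+ zero ] (ℤ.-<- (s≤s z≤n))))

frobenius-upper : ∀ {m} a (as : Vec ℕ (suc m)) → AllPositive (a ∷ as) → ∀ s F₁ Fₛ →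
  IsFrobeniusNumber 1 (a ∷ as) F₁ → IsFrobeniusNumber s (a ∷ as) Fₛ →
  (Fₛ ℤ.- F₁ ℤ.≤ ℤ.0ℤ) ⊎ ((Fₛ ℤ.- F₁) ℤ.^ suc m ℤ.≤ + ((s ∸ 1) ℕ.* (suc m !) ℕ.* prodVec (a ∷ as)))
frobenius-upper {m} a as pos s F₁ Fₛ fr₁ frₛ with Fₛ ℤ.- F₁ in gap
... | + zero   = inj₁ (ℤ.+≤+ z≤n)
... | -[1+ _ ] = inj₁ ℤ.-≤+
... | + suc d  = inj₂ (subst (ℤ._≤ _) (sym (pos-^ (suc d) (suc m)))
                   (ℤ.+≤+ (few-reps-bound a as pos (s ∸ 1) (suc d)
                     (few-reps-below-gap (a ∷ as) pos s F₁ Fₛ fr₁ frₛ (suc d) gap))))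

-- The main theorem.  The hypothesis gcd a = 1 only guarantees that the Frobenius
-- numbers exist; here they are given.  A zero entry is excluded
-- by positivity.
theorem1 : (n : ℕ) → 2 ℕ.≤ n → (a : Vec ℕ n) → AllPositive a → gcdVec a ≡ 1 →
    (s : ℕ) → 1 ℕ.≤ s → (F₁ Fₛ : ℤ) →
    IsFrobeniusNumber 1 a F₁ → IsFrobeniusNumber s a Fₛ →
    ((ℤ.0ℤ ℤ.< Fₛ ℤ.+ + Vec.sum a)
      × (+ (s ℕ.* ((n ∸ 1) !) ℕ.* prodVec a) ℤ.≤ (Fₛ ℤ.+ + Vec.sum a) ℤ.^ (n ∸ 1)))
    × ((Fₛ ℤ.- F₁ ℤ.≤ ℤ.0ℤ)
      ⊎ ((Fₛ ℤ.- F₁) ℤ.^ (n ∸ 1) ℤ.≤ + ((s ∸ 1) ℕ.* ((n ∸ 1) !) ℕ.* prodVec a)))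
theorem1 zero          ()
theorem1 (suc zero)    (s≤s ())
theorem1 (suc (suc m)) _ (suc a' ∷ as) pos _ s s≥1 F₁ Fₛ fr₁ frₛ =
  frobenius-lower a' as pos s s≥1 Fₛ frₛ , frobenius-upper (suc a') as pos s F₁ Fₛ fr₁ frₛ
theorem1 (suc (suc m)) _ (zero ∷ as) pos _ _ _ _ _ _ _ with head-pos pos
... | ()
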